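{- Let $G$ be a finite simple connected non-bipartite graph and let $2\leq x\leq y$ be integers. Then $\gamma_{P,c}(G\times K_{x,y})=\gamma_c(G\times K_2)$.
   Context: Power domination: for $S\subseteq V(X)$, start with $M(S)=N[S]$ and repeatedly add a vertex $w$ whenever some $v\in M(S)$ has $w$ as its unique neighbour outside $M(S)$; $S$ is a connected power dominating set if the final $M(S)$ is $V(X)$ and $\langle S\rangle$ is connected; $\gamma_{P,c}(X)$ is the minimum size of such a set. $\gamma_c(X)$ is the connected domination number (minimum size of a dominating set inducing a connected subgraph). The tensor product $G\times H$ has vertex set $V(G)\times V(H)$, with $(a,b)\sim(x,y)$ iff $ax\in E(G)$ and $by\in E(H)$. $K_{x,y}$ is the complete bipartite graph. -}

module Defs where

open import Data.Nat using (ℕ; _≤_)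
open import Data.Fin using (Fin)
open import Data.Bool using (Bool)
open import Data.List using (List; length)
open import Data.List.Membership.Propositional using (_∈_)
open import Data.List.Relation.Unary.Unique.Propositional using (Unique)
open import Data.Product using (Σ; _×_; ∃; ∃-syntax; _,_)
open import Data.Sum using (_⊎_; inj₁; inj₂)
open import Data.Unit using (⊤)
open import Data.Empty using (⊥)
open import Relation.Nullary using (¬_)
open import Relation.Binary.PropositionalEquality using (_≡_; _≢_)
open import Relation.Binary.Definitions using (Decidable)

record Graph : Set₁ where
  field
    n       : ℕ
    Adj     : Fin n → Fin n → Set
    adj?    : Decidable Adj
    sym     : ∀ {u v} → Adj u v → Adj v u
    irrefl  : ∀ {u} → ¬ Adj u u

-- Generic notions for a graph given by a vertex type V and adjacency E.
-- Vertex subsets S are duplicate-free lists; |S| = length S.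

module _ {V : Set} (E : V → V → Set) where

  data WalkIn (P : V → Set) : V → V → Set where
    here : ∀ {u} → P u → WalkIn P u u
    step : ∀ {u w v} → P u → E u w → WalkIn P w v → WalkIn P u v

  Connected : Set
  Connected = ∀ u v → WalkIn (λ _ → ⊤) u v

  Bipartite : Set
  Bipartite = Σ (V → Bool) λ c → ∀ (u v : V) → E u v → c u ≢ c v

  InducedConnected : List V → Set
  InducedConnected S = ∀ {u v} → u ∈ S → v ∈ S → WalkIn (λ w → w ∈ S) u v

  InClosedNbhd : List V → V → Set
  InClosedNbhd S w = w ∈ S ⊎ Σ V λ v → v ∈ S × E v w

  Dominating : List V → Set
  Dominating S = ∀ w → InClosedNbhd S w

  -- M(S): the least set containing N[S] and closed under the propagation
  -- rule "if v ∈ M(S) and w is the unique neighbour of v outside M(S),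
  -- add w" (i.e. the final set of the iterative process)
  data Monitored (S : List V) : V → Set where
    init : ∀ {w} → InClosedNbhd S w → Monitored S w
    prop : ∀ {v w} → Monitored S v → E v w
         → (∀ u → E v u → u ≢ w → Monitored S u) → Monitored S w

  PowerDominating : List V → Set
  PowerDominating S = ∀ w → Monitored S w

  IsConnectedDominatingSet : List V → Set
  IsConnectedDominatingSet S = Unique S × Dominating S × InducedConnected S

  IsConnectedPowerDominatingSet : List V → Set
  IsConnectedPowerDominatingSet S = Unique S × PowerDominating S × InducedConnected S

  IsMinSize : (List V → Set) → ℕ → Set
  IsMinSize Q k = (Σ (List V) λ S → Q S × length S ≡ k)
                × (∀ S → Q S → k ≤ length S)

  ConnDomNumber : ℕ → Set
  ConnDomNumber = IsMinSize IsConnectedDominatingSet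

  ConnPowerDomNumber : ℕ → Set
  ConnPowerDomNumber = IsMinSize IsConnectedPowerDominatingSet

_⊗_ : {A B : Set} → (A → A → Set) → (B → B → Set) → (A × B → A × B → Set)
(EA ⊗ EB) (a , b) (x , y) = EA a x × EB b y

KAdj : (x y : ℕ) → (Fin x ⊎ Fin y) → (Fin x ⊎ Fin y) → Set
KAdj x y (inj₁ _) (inj₂ _) = ⊤
KAdj x y (inj₂ _) (inj₁ _) = ⊤
KAdj x y (inj₁ _) (inj₁ _) = ⊥
KAdj x y (inj₂ _) (inj₂ _) = ⊥

K2Adj : (Fin 1 ⊎ Fin 1) → (Fin 1 ⊎ Fin 1) → Set
K2Adj = KAdj 1 1

{-# OPTIONS --safe #-}
-- Collapsing each part of K_{x,y} to a single vertex is a homomorphism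
-- G × K_{x,y} → G × K₂, and taking one vertex from each part is a homomorphism back.
-- Since x, y ≥ 2, every vertex of G × K_{x,y} has a false twin (same part, same G-coordinate),
-- so a vertex can never be the unique unmonitored neighbour of anything: power domination in
-- G × K_{x,y} is plain domination, and the image of a connected power dominating set is a
-- connected dominating set of G × K₂. Conversely a connected dominating set of G × K₂ is total
-- (every vertex has a neighbour in it), so its copy in G × K_{x,y} dominates every vertex.
-- Hence both minimisation problems have the same optimum; it exists because G × K₂ is connected
-- exactly when G is connected and non-bipartite, so its whole vertex set is a candidate.
module Submission where

open import Defs
open import Data.Bool using (Bool; true; false) renaming (_≟_ to _≟ᵇ_)
open import Data.Empty using (⊥-elim)
open import Data.Fin using (Fin; zero; suc) renaming (_≟_ to _≟ᶠ_)
open import Data.Fin.Properties using () renaming (any? to anyFin?)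
open import Data.List using (List; []; _∷_; length; filter; deduplicate; cartesianProduct; allFin)
import Data.List as List
open import Data.List.Properties using (length-map; length-deduplicate; filter-notAll)
open import Data.List.Membership.Propositional using (_∈_; _∉_; find; lose)
open import Data.List.Membership.Propositional.Properties
  using (∈-map⁺; ∈-map⁻; ∈-filter⁺; ∈-deduplicate⁺; ∈-deduplicate⁻; ∈-cartesianProduct⁺;
         ∈-allFin)
open import Data.List.Relation.Binary.Subset.Propositional using (_⊆_)
open import Data.List.Relation.Unary.All using (All; all?; [])
import Data.List.Relation.Unary.All as All
open import Data.List.Relation.Unary.All.Properties using (¬Any⇒All¬)
open import Data.List.Relation.Unary.Any using (Any; here; there; any?)
open import Data.List.Relation.Unary.AllPairs using ([]; _∷_)
open import Data.List.Relation.Unary.Unique.Propositional using (Unique)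
import Data.List.Relation.Unary.Unique.Propositional.Properties as Unique
open import Data.List.Relation.Unary.Unique.DecPropositional using (unique?)
open import Data.List.Relation.Unary.Unique.DecPropositional.Properties using (deduplicate-!)
import Data.List.Membership.DecPropositional as DecMembership
open import Data.Nat using (ℕ; zero; suc; _+_; _≤_; _<_; z≤n; s≤s)
open import Data.Nat.Induction using (<-rec)
open import Data.Nat.Properties
  using (≤-refl; ≤-trans; ≤-antisym; ≤-reflexive; m≤m+n; +-suc; ≮⇒≥; <⇒≱; anyUpTo?; suc-injective;
         module ≤-Reasoning)
open import Data.Product using (Σ; ∃; ∃₂; _×_; _,_; proj₁; proj₂; map₂)
import Data.Product.Properties as Product
open import Data.Sum using (_⊎_; inj₁; inj₂)
import Data.Sum.Properties as Sum
open import Data.Unit using (⊤; tt)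
open import Function using (_∘_; id)
open import Relation.Binary.Definitions using (DecidableEquality; Symmetric)
import Relation.Binary.Definitions as B
open import Relation.Binary.PropositionalEquality using (_≡_; _≢_; refl; sym; trans; cong; subst)
open import Relation.Nullary using (¬_; Dec; yes; no; ¬?)
open import Relation.Nullary.Decidable using (map′; decidable-stable; _×-dec_; _⊎-dec_)
open import Relation.Unary using (Decidable)

private variable
  V W : Set
  E : V → V → Set
  F : W → W → Set
  P Q : V → Set
  S T : List V
  u v w : V
  k : ℕ

module Walk where

  head : WalkIn E P u v → P u
  head (here p)     = p
  head (step p _ _) = p

  _++_ : WalkIn E P u v → WalkIn E P v w → WalkIn E P u w
  here _       ++ walk = walk
  step p e w₁ ++ w₂   = step p e (w₁ ++ w₂)

  reverse : Symmetric E → WalkIn E P u v → WalkIn E P v u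
  reverse E-sym (here p)          = here p
  reverse E-sym (step p e walk) = reverse E-sym walk ++ step (head walk) (E-sym e) (here p)

  map : (f : V → W) → (∀ {a b} → E a b → F (f a) (f b)) → (∀ {a} → P a → Q (f a))
      → WalkIn E P u v → WalkIn F Q (f u) (f v)
  map f hom pres (here p)        = here (pres p)
  map f hom pres (step p e walk) = step (pres p) (hom e) (map f hom pres walk)

open Walk using (_++_)

InClosedNbhd-mono : S ⊆ T → InClosedNbhd E S w → InClosedNbhd E T w
InClosedNbhd-mono S⊆T (inj₁ w∈S)            = inj₁ (S⊆T w∈S)
InClosedNbhd-mono S⊆T (inj₂ (v , v∈S , e)) = inj₂ (v , S⊆T v∈S , e)

InClosedNbhd-map : (f : V → W) → (∀ {a b} → E a b → F (f a) (f b))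
                 → InClosedNbhd E S w → InClosedNbhd F (List.map f S) (f w)
InClosedNbhd-map f hom (inj₁ w∈S)            = inj₁ (∈-map⁺ f w∈S)
InClosedNbhd-map f hom (inj₂ (v , v∈S , e)) = inj₂ (f v , ∈-map⁺ f v∈S , hom e)

InducedConnected-⊆ : S ⊆ T → T ⊆ S → InducedConnected E S → InducedConnected E T
InducedConnected-⊆ S⊆T T⊆S conn u∈T v∈T = Walk.map id id S⊆T (conn (T⊆S u∈T) (T⊆S v∈T))

InducedConnected-map : (f : V → W) → (∀ {a b} → E a b → F (f a) (f b))
                     → InducedConnected E S → InducedConnected F (List.map f S)
InducedConnected-map f hom conn u∈fS v∈fS with ∈-map⁻ f u∈fS | ∈-map⁻ f v∈fS
... | _ , u∈S , refl | _ , v∈S , refl = Walk.map f hom (∈-map⁺ f) (conn u∈S v∈S)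

InducedConnected⇒neighbour : InducedConnected E S → u ∈ S → v ∈ S → u ≢ v
                           → ∃ λ w → w ∈ S × E u w
InducedConnected⇒neighbour conn u∈S v∈S u≢v with conn u∈S v∈S
... | here _        = ⊥-elim (u≢v refl)
... | step _ e walk = _ , Walk.head walk , e

-- A vertex with a false twin is never the unique unmonitored neighbour of anything, so
-- propagation cannot leave a twin-closed superset of N[S].
Monitored⊆twin-closed : (twin : V → V) → (∀ w → twin w ≢ w) → (∀ {v w} → E v w → E v (twin w))
                      → (P : V → Set) → (∀ {w} → InClosedNbhd E S w → P w)
                      → (∀ {w} → P (twin w) → P w)
                      → Monitored E S w → P w
Monitored⊆twin-closed twin twin-≢ twin-adj P N⊆P P-closed (init w∈N) = N⊆P w∈N
Monitored⊆twin-closed twin twin-≢ twin-adj P N⊆P P-closed (prop {w = w} _ e others) =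
  P-closed (Monitored⊆twin-closed twin twin-≢ twin-adj P N⊆P P-closed
             (others (twin w) (twin-adj e) (twin-≢ w)))

-- IsMinSize ignores its graph argument, so E and F cannot be inferred and are explicit.
module _ {V : Set} (E : V → V → Set) {W : Set} (F : W → W → Set)
         {Q : List V → Set} {R : List W → Set} where

  IsMinSize-transfer : (∀ S → Q S → ∃ λ T → R T × length T ≤ length S)
                     → (∀ T → R T → ∃ λ S → Q S × length S ≤ length T)
                     → IsMinSize E Q k → IsMinSize F R k
  IsMinSize-transfer up down ((S , qS , refl) , minimal) = witness (up S qS) , lower-bound
    where
    lower-bound : ∀ T → R T → length S ≤ length T
    lower-bound T rT = let S′ , qS′ , S′≤T = down T rT in ≤-trans (minimal S′ qS′) S′≤T

    witness : (∃ λ T → R T × length T ≤ length S) → Σ (List W) λ T → R T × length T ≡ length S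
    witness (T , rT , T≤S) = T , rT , ≤-antisym T≤S (lower-bound T rT)

-- Unlike InducedConnected, Chain is decidable, and every connected set can be listed as a chain.
data Chain {V : Set} (E : V → V → Set) : List V → Set where
  []     : Chain E []
  single : ∀ x → Chain E (x ∷ [])
  _∷_    : ∀ {x xs} → Any (E x) xs → Chain E xs → Chain E (x ∷ xs)

chain? : B.Decidable E → Decidable (Chain E)
chain? E? []           = yes []
chain? E? (x ∷ [])     = yes (single x)
chain? E? (x ∷ y ∷ xs) with any? (E? x) (y ∷ xs) | chain? E? (y ∷ xs)
... | yes adj | yes chain = yes (adj ∷ chain)
... | no ¬adj | _         = no λ { (adj ∷ _) → ¬adj adj }
... | _       | no ¬chain = no λ { (_ ∷ chain) → ¬chain chain }

Chain⇒InducedConnected : Symmetric E → Chain E S → InducedConnected E S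
Chain⇒InducedConnected {E = E} E-sym = connected
  where
  weaken : ∀ {x xs} → WalkIn E (_∈ xs) u v → WalkIn E (_∈ x ∷ xs) u v
  weaken = Walk.map id id there

  connected : Chain E S → InducedConnected E S
  from-head : ∀ {x xs} → Any (E x) xs → Chain E xs → v ∈ xs → WalkIn E (_∈ x ∷ xs) x v
  from-head adj chain v∈xs with find adj
  ... | y , y∈xs , e = step (here refl) e (weaken (connected chain y∈xs v∈xs))

  connected (single x) (here refl)   (here refl)   = here (here refl)
  connected (adj ∷ chain) (here refl) (here refl)  = here (here refl)
  connected (adj ∷ chain) (here refl) (there v∈xs) = from-head adj chain v∈xs
  connected (adj ∷ chain) (there u∈xs) (here refl) = Walk.reverse E-sym (from-head adj chain u∈xs)
  connected (adj ∷ chain) (there u∈xs) (there v∈xs) = weaken (connected chain u∈xs v∈xs)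

module _ {V : Set} (_≟_ : DecidableEquality V) where
  open DecMembership _≟_ using (_∈?_)

  Unique-⊆⇒length≤ : ∀ {S T} → Unique T → T ⊆ S → length T ≤ length S
  Unique-⊆⇒length≤ [] _ = z≤n
  Unique-⊆⇒length≤ {S} {t ∷ T} (t≢T ∷ unique) t∷T⊆S = begin-strict
    length T                   ≤⟨ Unique-⊆⇒length≤ unique T⊆S-t ⟩
    length (filter ≢t? S)      <⟨ filter-notAll ≢t? S (lose (t∷T⊆S (here refl)) λ t≢t → t≢t refl) ⟩
    length S                   ∎
    where
    open ≤-Reasoning
    ≢t? : Decidable (_≢ t)
    ≢t? = ¬? ∘ (_≟ t)

    T⊆S-t : T ⊆ filter ≢t? S
    T⊆S-t z∈T = ∈-filter⁺ ≢t? (t∷T⊆S (there z∈T)) λ z≡t → All.lookup t≢T z∈T (sym z≡t)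

  ⊆-or-escapes : ∀ (S T : List V) → S ⊆ T ⊎ ∃ λ r → r ∈ S × r ∉ T
  ⊆-or-escapes S T with any? (λ r → ¬? (r ∈? T)) S
  ... | yes escape = inj₂ (find escape)
  ... | no none    = inj₁ λ r∈S → decidable-stable (_ ∈? T) (none ∘ lose r∈S)

  WalkIn-exit : ∀ {E : V → V → Set} {S T u v} → WalkIn E (_∈ S) u v → u ∈ T → v ∉ T
              → ∃₂ λ a b → a ∈ T × b ∈ S × b ∉ T × E a b
  WalkIn-exit (here _) u∈T v∉T = ⊥-elim (v∉T u∈T)
  WalkIn-exit {T = T} (step {w = w} _ e walk) u∈T v∉T with w ∈? T
  ... | yes w∈T = WalkIn-exit walk w∈T v∉T
  ... | no w∉T  = _ , w , u∈T , Walk.head walk , w∉T , e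

  module _ {E : V → V → Set} (E-sym : Symmetric E) where

    ChainIn : List V → List V → Set
    ChainIn S T = Unique T × Chain E T × T ⊆ S

    adjoin : ∀ {S T a b} → ChainIn S T → b ∈ S → b ∉ T → a ∈ T → E b a → ChainIn S (b ∷ T)
    adjoin {T = T} (unique , chain , T⊆S) b∈S b∉T a∈T e =
      ¬Any⇒All¬ T b∉T ∷ unique , lose a∈T e ∷ chain ,
      λ { (here refl) → b∈S ; (there z∈T) → T⊆S z∈T }

    ChainIn-length : ∀ {S T} → ChainIn S T → length T ≤ length S
    ChainIn-length (unique , _ , T⊆S) = Unique-⊆⇒length≤ unique T⊆S

    -- The fuel f bounds the number of vertices of S still missing from T.
    grow : ∀ {S T u} → InducedConnected E S → ∀ f → ChainIn S T → u ∈ T → length S ≤ f + length T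
         → ∃ λ T′ → ChainIn S T′ × S ⊆ T′
    grow {S = S} {T = T} conn f chainIn@(_ , _ , T⊆S) u∈T len with ⊆-or-escapes S T
    ... | inj₁ S⊆T = T , chainIn , S⊆T
    ... | inj₂ (r , r∈S , r∉T) with WalkIn-exit (conn (T⊆S u∈T) r∈S) u∈T r∉T
    ... | a , b , a∈T , b∈S , b∉T , e with f | adjoin chainIn b∈S b∉T a∈T (E-sym e)
    ... | zero  | chainIn′ = ⊥-elim (<⇒≱ (ChainIn-length chainIn′) len)
    ... | suc f | chainIn′ =
      grow conn f chainIn′ (there u∈T) (≤-trans len (≤-reflexive (sym (+-suc f (length T)))))

    InducedConnected⇒Chain : ∀ {S} → InducedConnected E S → ∃ λ T → ChainIn S T × S ⊆ T
    InducedConnected⇒Chain {[]}    _    = [] , ([] , [] , λ ()) , λ ()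
    InducedConnected⇒Chain {s ∷ S} conn =
      grow conn (length (s ∷ S)) ([] ∷ [] , single s , λ { (here refl) → here refl }) (here refl)
           (m≤m+n _ _)

least : {P : ℕ → Set} → Decidable P → P k → ∃ λ m → P m × (∀ j → P j → m ≤ j)
least {k = k} {P = P} P? = <-rec (λ k → P k → ∃ λ m → P m × (∀ j → P j → m ≤ j)) search k
  where
  search : ∀ k → (∀ {j} → j < k → P j → ∃ λ m → P m × (∀ j → P j → m ≤ j)) → P k
         → ∃ λ m → P m × (∀ j → P j → m ≤ j)
  search k smaller pk with anyUpTo? P? k
  ... | yes (j , j<k , pj) = smaller j<k pj
  ... | no none            = k , pk , λ j pj → ≮⇒≥ λ j<k → none (j , j<k , pj)

module FiniteGraph {V : Set} (E : V → V → Set) (E? : B.Decidable E) (E-sym : Symmetric E)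
                   (_≟_ : DecidableEquality V)
                   (vertices : List V) (∈-vertices : ∀ v → v ∈ vertices) where
  open DecMembership _≟_ using (_∈?_)

  ∃? : ∀ {P : V → Set} → Decidable P → Dec (Σ V P)
  ∃? P? = map′ (λ any → let v , _ , p = find any in v , p) (λ (v , p) → lose (∈-vertices v) p)
                (any? P? vertices)

  ∀? : ∀ {P : V → Set} → Decidable P → Dec (∀ v → P v)
  ∀? P? = map′ (λ all v → All.lookup all (∈-vertices v)) (λ p → All.tabulate λ {v} _ → p v)
                (all? P? vertices)

  dominating? : Decidable (Dominating E)
  dominating? S = ∀? λ w →
    (w ∈? S) ⊎-dec map′ find (λ (v , v∈S , e) → lose v∈S e) (any? (λ v → E? v w) S)

  ofLength? : {Q : List V → Set} → Decidable Q → ∀ k → Dec (Σ (List V) λ S → Q S × length S ≡ k)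
  ofLength? Q? zero with Q? []
  ... | yes q = yes ([] , q , refl)
  ... | no ¬q = no λ { ([] , q , _) → ¬q q }
  ofLength? Q? (suc k) with ∃? (λ v → ofLength? (Q? ∘ (v ∷_)) k)
  ... | yes (v , S , q , len) = yes (v ∷ S , q , cong suc len)
  ... | no none               =
    no λ { ([] , _ , ()) ; (v ∷ S , q , len) → none (v , S , q , suc-injective len) }

  IsChainDominatingSet : List V → Set
  IsChainDominatingSet S = Unique S × Dominating E S × Chain E S

  chainDominating? : Decidable IsChainDominatingSet
  chainDominating? S = unique? _≟_ S ×-dec dominating? S ×-dec chain? E? S

  IsConnectedDominatingSet⇒Chain : ∀ S → IsConnectedDominatingSet E S
                                 → ∃ λ T → IsChainDominatingSet T × length T ≤ length S
  IsConnectedDominatingSet⇒Chain S (_ , dominating , conn) with InducedConnected⇒Chain _≟_ E-sym conn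
  ... | T , chainIn@(unique , chain , _) , S⊆T =
    T , (unique , (λ w → InClosedNbhd-mono {E = E} S⊆T (dominating w)) , chain) ,
    ChainIn-length _≟_ E-sym chainIn

  IsChainDominatingSet⇒Connected : ∀ S → IsChainDominatingSet S
                                 → ∃ λ T → IsConnectedDominatingSet E T × length T ≤ length S
  IsChainDominatingSet⇒Connected S (unique , dominating , chain) =
    S , (unique , dominating , Chain⇒InducedConnected E-sym chain) , ≤-refl

  IsMinSize-exists : (Q : List V → Set) → Decidable Q → ∃ Q → ∃ (IsMinSize E Q)
  IsMinSize-exists Q Q? (S , qS) with least (ofLength? Q?) (S , qS , refl)
  ... | k , witness , minimal = k , witness , λ T qT → minimal (length T) (T , qT , refl)

  Connected⇒InducedConnected-vertices : Connected E → InducedConnected E vertices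
  Connected⇒InducedConnected-vertices conn {u} {v} _ _ = Walk.map id id (λ {w} _ → ∈-vertices w) (conn u v)

  Connected⇒chainDominating : Connected E → ∃ IsChainDominatingSet
  Connected⇒chainDominating conn
    with InducedConnected⇒Chain _≟_ E-sym (Connected⇒InducedConnected-vertices conn)
  ... | T , (unique , chain , _) , vertices⊆T =
    T , unique , (λ w → inj₁ (vertices⊆T (∈-vertices w))) , chain

  ConnDomNumber-exists : Connected E → ∃ (ConnDomNumber E)
  ConnDomNumber-exists conn
    with IsMinSize-exists IsChainDominatingSet chainDominating? (Connected⇒chainDominating conn)
  ... | k , minimum =
    k , IsMinSize-transfer E E IsChainDominatingSet⇒Connected IsConnectedDominatingSet⇒Chain minimum

Side : Set
Side = Fin 1 ⊎ Fin 1

left : Side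
left = inj₁ zero

opposite : Side → Side
opposite (inj₁ _) = inj₂ zero
opposite (inj₂ _) = inj₁ zero

opposite-≢ : ∀ s → s ≢ opposite s
opposite-≢ (inj₁ _) ()
opposite-≢ (inj₂ _) ()

K2Adj-opposite : ∀ s → K2Adj s (opposite s)
K2Adj-opposite (inj₁ _) = tt
K2Adj-opposite (inj₂ _) = tt

K2Adj? : B.Decidable K2Adj
K2Adj? (inj₁ _) (inj₁ _) = no λ ()
K2Adj? (inj₁ _) (inj₂ _) = yes tt
K2Adj? (inj₂ _) (inj₁ _) = yes tt
K2Adj? (inj₂ _) (inj₂ _) = no λ ()

KAdj-sym : ∀ {x y s t} → KAdj x y s t → KAdj x y t s
KAdj-sym {s = inj₁ _} {t = inj₂ _} _ = tt
KAdj-sym {s = inj₂ _} {t = inj₁ _} _ = tt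

isLeft : Side → Bool
isLeft (inj₁ _) = true
isLeft (inj₂ _) = false

isLeft-injective : ∀ {s t} → isLeft s ≡ isLeft t → s ≡ t
isLeft-injective {inj₁ zero} {inj₁ zero} _ = refl
isLeft-injective {inj₂ zero} {inj₂ zero} _ = refl

_≟ˢ_ : DecidableEquality Side
_≟ˢ_ = Sum.≡-dec _≟ᶠ_ _≟ᶠ_

module DoubleCover (G : Graph) where
  open Graph G renaming (sym to Adj-sym)

  Adj₂ : Fin n × Side → Fin n × Side → Set
  Adj₂ = Adj ⊗ K2Adj

  Adj₂-sym : Symmetric Adj₂
  Adj₂-sym (e , k) = Adj-sym e , KAdj-sym k

  Walk₂ : Fin n × Side → Fin n × Side → Set
  Walk₂ = WalkIn Adj₂ (λ _ → ⊤)

  lift : ∀ {g h} → WalkIn Adj P g h → ∀ s → ∃ λ t → Walk₂ (g , s) (h , t)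
  lift (here _)        s = s , here tt
  lift (step _ e walk) s with lift walk (opposite s)
  ... | t , walk₂ = t , step tt (e , K2Adj-opposite s) walk₂

  reach-both-sides : ∀ {g h z} → WalkIn Adj P g h → (∀ s → Walk₂ (h , s) z) → ∀ s → Walk₂ (g , s) z
  reach-both-sides (here _)        both s = both s
  reach-both-sides (step _ e walk) both s =
    step tt (e , K2Adj-opposite s) (reach-both-sides walk both (opposite s))

  nonBipartite⇒monochromatic : ¬ Bipartite Adj → ∀ c → ∃₂ λ p q → Adj p q × c p ≡ c q
  nonBipartite⇒monochromatic nonbip c with anyFin? (λ p → anyFin? λ q → adj? p q ×-dec (c p ≟ᵇ c q))
  ... | yes (p , q , e , same) = p , q , e , same
  ... | no none                = ⊥-elim (nonbip (c , λ p q e same → none (p , q , e , same)))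

  module _ (conn : Connected Adj) (g₀ : Fin n) where

    endSide : Fin n → Side
    endSide h = proj₁ (lift (conn h g₀) left)

    -- The edge p q and the lifted walks from p and q to g₀ form an odd closed walk through p,
    -- which is what joins both lifts of p to the same vertex (g₀ , endSide p).
    reach-target : ∀ {p q} → Adj p q → endSide p ≡ endSide q → ∀ w → Walk₂ w (g₀ , endSide p)
    reach-target {p} {q} e same (h , s) = reach-both-sides (conn h p) both s
      where
      both : ∀ s → Walk₂ (p , s) (g₀ , endSide p)
      both (inj₁ zero) = proj₂ (lift (conn p g₀) left)
      both (inj₂ zero) =
        step tt (e , tt) (subst (Walk₂ (q , left) ∘ (g₀ ,_)) (sym same) (proj₂ (lift (conn q g₀) left)))

  connected : Connected Adj → ¬ Bipartite Adj → Connected Adj₂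
  connected conn nonbip u v with nonBipartite⇒monochromatic nonbip (isLeft ∘ endSide conn (proj₁ u))
  ... | p , q , e , same = reach u ++ Walk.reverse Adj₂-sym (reach v)
    where
    reach : ∀ w → Walk₂ w (proj₁ u , endSide conn (proj₁ u) p)
    reach = reach-target conn (proj₁ u) e (isLeft-injective same)

  sides : List Side
  sides = inj₁ zero ∷ inj₂ zero ∷ []

  ∈-sides : ∀ s → s ∈ sides
  ∈-sides (inj₁ zero) = here refl
  ∈-sides (inj₂ zero) = there (here refl)

  open FiniteGraph Adj₂ (λ (g , s) (h , t) → adj? g h ×-dec K2Adj? s t) Adj₂-sym
                   (Product.≡-dec _≟ᶠ_ _≟ˢ_) (cartesianProduct (allFin n) sides)
                   (λ (g , s) → ∈-cartesianProduct⁺ (∈-allFin g) (∈-sides s))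
    public using (ConnDomNumber-exists)

module _ {A : Set} (R : A → A → Set) (R-sym : Symmetric R) (R-irrefl : ∀ {a} → ¬ R a a)
         (_≟_ : DecidableEquality A) (x y : ℕ) where

  Part : Set
  Part = Fin (suc (suc x)) ⊎ Fin (suc (suc y))

  Kxy : Part → Part → Set
  Kxy = KAdj (suc (suc x)) (suc (suc y))

  R₂ : A × Side → A × Side → Set
  R₂ = R ⊗ K2Adj

  Rxy : A × Part → A × Part → Set
  Rxy = R ⊗ Kxy

  collapse : Part → Side
  collapse (inj₁ _) = inj₁ zero
  collapse (inj₂ _) = inj₂ zero

  embed : Side → Part
  embed (inj₁ _) = inj₁ zero
  embed (inj₂ _) = inj₂ zero

  collapse-embed : ∀ s → collapse (embed s) ≡ s
  collapse-embed (inj₁ zero) = refl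
  collapse-embed (inj₂ zero) = refl

  collapse-hom : ∀ {s t} → Kxy s t → K2Adj (collapse s) (collapse t)
  collapse-hom {inj₁ _} {inj₂ _} _ = tt
  collapse-hom {inj₂ _} {inj₁ _} _ = tt

  embed-adj : ∀ {s t} → K2Adj s (collapse t) → Kxy (embed s) t
  embed-adj {inj₁ _} {inj₂ _} _ = tt
  embed-adj {inj₂ _} {inj₁ _} _ = tt

  embed-hom : ∀ {s t} → K2Adj s t → Kxy (embed s) (embed t)
  embed-hom {s} {t} k = embed-adj (subst (K2Adj s) (sym (collapse-embed t)) k)

  partner : ∀ {m} → Fin (suc (suc m)) → Fin (suc (suc m))
  partner zero    = suc zero
  partner (suc _) = zero

  twin : Part → Part
  twin (inj₁ i) = inj₁ (partner i)
  twin (inj₂ j) = inj₂ (partner j)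

  twin-≢ : ∀ t → twin t ≢ t
  twin-≢ (inj₁ zero)    ()
  twin-≢ (inj₁ (suc _)) ()
  twin-≢ (inj₂ zero)    ()
  twin-≢ (inj₂ (suc _)) ()

  twin-adj : ∀ {s t} → Kxy s t → Kxy s (twin t)
  twin-adj {inj₁ _} {inj₂ _} _ = tt
  twin-adj {inj₂ _} {inj₁ _} _ = tt

  collapse-twin : ∀ t → collapse (twin t) ≡ collapse t
  collapse-twin (inj₁ _) = refl
  collapse-twin (inj₂ _) = refl

  π : A × Part → A × Side
  π = map₂ collapse

  ι : A × Side → A × Part
  ι = map₂ embed

  π-ι : ∀ v → π (ι v) ≡ v
  π-ι (a , s) = cong (a ,_) (collapse-embed s)

  π-hom : ∀ {u v} → Rxy u v → R₂ (π u) (π v)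
  π-hom (r , k) = r , collapse-hom k

  ι-hom : ∀ {u v} → R₂ u v → Rxy (ι u) (ι v)
  ι-hom (r , k) = r , embed-hom k

  ι-injective : ∀ {u v} → ι u ≡ ι v → u ≡ v
  ι-injective eq = trans (sym (π-ι _)) (trans (cong π eq) (π-ι _))

  R₂-sym : Symmetric R₂
  R₂-sym (r , k) = R-sym r , KAdj-sym k

  _≟₂_ : DecidableEquality (A × Side)
  _≟₂_ = Product.≡-dec _≟_ _≟ˢ_

  ConnectedDominating⇒total : ∀ {D} → IsConnectedDominatingSet R₂ D
                            → ∀ p → ∃ λ v → v ∈ D × R₂ v p
  ConnectedDominating⇒total {D} (_ , dominating , conn) p@(a , s) with dominating p
  ... | inj₂ neighbour = neighbour
  ... | inj₁ p∈D = reversed (neighbour-of-p (dominating (a , opposite s)))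
    where
    reversed : (∃ λ v → v ∈ D × R₂ p v) → ∃ λ v → v ∈ D × R₂ v p
    reversed (v , v∈D , r) = v , v∈D , R₂-sym r

    neighbour-of-p : InClosedNbhd R₂ D (a , opposite s) → ∃ λ v → v ∈ D × R₂ p v
    neighbour-of-p (inj₁ q∈D) = InducedConnected⇒neighbour conn p∈D q∈D (opposite-≢ s ∘ cong proj₂)
    neighbour-of-p (inj₂ (v , v∈D , r , _)) =
      InducedConnected⇒neighbour conn p∈D v∈D λ { refl → R-irrefl r }

  Monitored⇒InClosedNbhd-π : ∀ {S w} → Monitored Rxy S w → InClosedNbhd R₂ (List.map π S) (π w)
  Monitored⇒InClosedNbhd-π {S} =
    Monitored⊆twin-closed {E = Rxy} (map₂ twin) (λ (_ , t) → twin-≢ t ∘ cong proj₂)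
      (λ (r , k) → r , twin-adj k)
      (InClosedNbhd R₂ (List.map π S) ∘ π) (InClosedNbhd-map {E = Rxy} {F = R₂} π π-hom)
      (λ {(a , t)} → subst (InClosedNbhd R₂ (List.map π S)) (cong (a ,_) (collapse-twin t)))

  IsConnectedPowerDominatingSet-collapse : ∀ S → IsConnectedPowerDominatingSet Rxy S
                → ∃ λ T → IsConnectedDominatingSet R₂ T × length T ≤ length S
  IsConnectedPowerDominatingSet-collapse S (_ , powerDominating , conn) =
    image , (deduplicate-! _≟₂_ πS , dominating , connected) ,
    ≤-trans (length-deduplicate _≟₂_ πS) (≤-reflexive (length-map π S))
    where
    πS : List (A × Side)
    πS = List.map π S

    image : List (A × Side)
    image = deduplicate _≟₂_ πS

    dominating : Dominating R₂ image
    dominating w = InClosedNbhd-mono {E = R₂} (∈-deduplicate⁺ _≟₂_)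
      (subst (InClosedNbhd R₂ πS) (π-ι w) (Monitored⇒InClosedNbhd-π (powerDominating (ι w))))

    connected : InducedConnected R₂ image
    connected = InducedConnected-⊆ (∈-deduplicate⁺ _≟₂_) (∈-deduplicate⁻ _≟₂_ πS)
                  (InducedConnected-map {E = Rxy} {F = R₂} π π-hom conn)

  IsConnectedDominatingSet-embed : ∀ D → IsConnectedDominatingSet R₂ D
            → ∃ λ S → IsConnectedPowerDominatingSet Rxy S × length S ≤ length D
  IsConnectedDominatingSet-embed D cds@(unique , _ , conn) =
    List.map ι D ,
    (Unique.map⁺ ι-injective unique , powerDominating , InducedConnected-map {E = R₂} {F = Rxy} ι ι-hom conn) ,
    ≤-reflexive (length-map ι D)
    where
    powerDominating : PowerDominating Rxy (List.map ι D)
    powerDominating w with ConnectedDominating⇒total cds (π w)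
    ... | v , v∈D , r , k = init (inj₂ (ι v , ∈-map⁺ ι v∈D , r , embed-adj k))

  ConnDomNumber⇒ConnPowerDomNumber : ConnDomNumber R₂ k → ConnPowerDomNumber Rxy k
  ConnDomNumber⇒ConnPowerDomNumber =
    IsMinSize-transfer R₂ Rxy IsConnectedDominatingSet-embed IsConnectedPowerDominatingSet-collapse

theorem13 : (G : Graph) → Connected (Graph.Adj G) → ¬ Bipartite (Graph.Adj G)
    → (x y : ℕ) → 2 ≤ x → x ≤ y
    → Σ ℕ λ k → ConnPowerDomNumber (Graph.Adj G ⊗ KAdj x y) k
                × ConnDomNumber (Graph.Adj G ⊗ K2Adj) k
theorem13 G conn nonbip (suc (suc x)) (suc (suc y)) _ _
  with DoubleCover.ConnDomNumber-exists G (DoubleCover.connected G conn nonbip)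
... | γc , isConnDomNumber =
  γc , ConnDomNumber⇒ConnPowerDomNumber Adj Adj-sym irrefl _≟ᶠ_ x y isConnDomNumber , isConnDomNumber
  where open Graph G renaming (sym to Adj-sym)
theorem13 G conn nonbip (suc (suc x)) (suc zero) _ (s≤s ())
theorem13 G conn nonbip (suc (suc x)) zero      _ ()
theorem13 G conn nonbip (suc zero)    y (s≤s ()) _
theorem13 G conn nonbip zero          y ()       _
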